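{- Let $\Gamma$ be a connected cubic graph admitting a partition of its edge set into a $2$-factor $\mathcal{C}$ and a $1$-factor $\mathcal{I}$ such that $|\mathcal{C}| \ge 3$ and the quotient graph $\Gamma_{\mathcal{C}}$ is a cycle. Suppose there exists a vertex-transitive subgroup $G \le \mathrm{Aut}(\Gamma)$ preserving this partition. Then the group induced by the action of $G$ on $\Gamma_{\mathcal{C}}$ is the dihedral group of order $2m$, where $m = |\mathcal{C}|$.
   Context: A $2$-factor is viewed as the set of its cycles. The quotient graph $\Gamma_{\mathcal{C}}$ is the simple graph with vertex set $\mathcal{C}$ in which distinct $C,C'\in\mathcal{C}$ are adjacent iff some vertex of $C$ is adjacent in $\Gamma$ to some vertex of $C'$. $G$ preserves the partition if it maps cycles of $\mathcal{C}$ to cycles of $\mathcal{C}$ (equivalently, preserves $\mathcal{I}$). -}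

module Defs where

open import Data.Nat using (ℕ; _+_; _*_; _≤_)
open import Data.Fin using (Fin; toℕ)
open import Data.List using (length; filter; allFin)
open import Data.Product using (Σ; ∃; _×_; _,_)
open import Data.Sum using (_⊎_)
open import Data.Bool using (Bool; true; false)
open import Function.Bundles using (_⇔_)
open import Relation.Nullary using (¬_)
open import Level using (0ℓ)
open import Relation.Binary using (Rel; Decidable; Symmetric; Irreflexive)
open import Relation.Binary.PropositionalEquality using (_≡_)
open import Relation.Binary.Construct.Closure.ReflexiveTransitive using (Star)
open import Data.Fin.Permutation using (Permutation′; _⟨$⟩ʳ_; _⟨$⟩ˡ_)

record Graph (n : ℕ) : Set₁ where
  field
    Adj    : Rel (Fin n) 0ℓ
    adj?   : Decidable Adj
    sym    : Symmetric Adj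
    irrefl : Irreflexive _≡_ Adj
open Graph public

degree : ∀ {n} {R : Rel (Fin n) 0ℓ} → Decidable R → Fin n → ℕ
degree {n} R? i = length (filter (λ j → R? i j) (allFin n))

Cubic : ∀ {n} → Graph n → Set
Cubic Γ = ∀ i → degree (adj? Γ) i ≡ 3


Connected : ∀ {n} → Graph n → Set
Connected Γ = ∀ i j → Star (Adj Γ) i j

IEdge : ∀ {n} (Γ : Graph n) (F : Rel (Fin n) 0ℓ) → Rel (Fin n) 0ℓ
IEdge Γ F i j = Adj Γ i j × ¬ F i j

record TwoFactorOneFactor {n} (Γ : Graph n) (F : Rel (Fin n) 0ℓ) : Set where
  field
    F?       : Decidable F
    F-sym    : Symmetric F
    F⊆Adj    : ∀ {i j} → F i j → Adj Γ i j
    I?       : Decidable (IEdge Γ F)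
    F-2reg   : ∀ i → degree F? i ≡ 2
    I-1reg   : ∀ i → degree I? i ≡ 1

-- κ : Fin n → Fin m labels the cycles of the 2-factor F (the connected
-- components of the subgraph with edge set F) bijectively by Fin m.
CycleLabelling : ∀ {n m} (F : Rel (Fin n) 0ℓ) (κ : Fin n → Fin m) → Set
CycleLabelling F κ =
  (∀ a → ∃ λ i → κ i ≡ a) × (∀ i j → (κ i ≡ κ j) ⇔ Star F i j)

QAdj : ∀ {n m} (Γ : Graph n) (κ : Fin n → Fin m) → Rel (Fin m) 0ℓ
QAdj Γ κ a b = ¬ a ≡ b × ∃ λ i → ∃ λ j → κ i ≡ a × κ j ≡ b × Adj Γ i j

CongMod : ℕ → ℕ → ℕ → Set
CongMod m a b = ∃ λ q → (a + q * m ≡ b) ⊎ (b + q * m ≡ a)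

IsCycle : ∀ {m} → Rel (Fin m) 0ℓ → Set
IsCycle {m} Q = Σ (Permutation′ m) λ ψ → ∀ a b →
  Q a b ⇔ (CongMod m (toℕ (ψ ⟨$⟩ʳ a)) (toℕ (ψ ⟨$⟩ʳ b) + 1)
           ⊎ CongMod m (toℕ (ψ ⟨$⟩ʳ b)) (toℕ (ψ ⟨$⟩ʳ a) + 1))

-- the natural dihedral permutations of Z_m of order 2m:
-- x ↦ x + k  (ε = false)  and  x ↦ k - x  (ε = true)
DihedralMap : (m : ℕ) → Bool → ℕ → ℕ → ℕ → Set
DihedralMap m false k x y = CongMod m (y) (x + k)
DihedralMap m true  k x y = CongMod m (y + x) (k)

record IsSubgroup {n} (G : Permutation′ n → Set) : Set where
  field
    has-id  : ∃ λ e → G e × ∀ i → e ⟨$⟩ʳ i ≡ i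
    has-mul : ∀ g h → G g → G h → ∃ λ k → G k × ∀ i → k ⟨$⟩ʳ i ≡ g ⟨$⟩ʳ (h ⟨$⟩ʳ i)
    has-inv : ∀ g → G g → ∃ λ k → G k × ∀ i → k ⟨$⟩ʳ i ≡ g ⟨$⟩ˡ i

IsAutomorphism : ∀ {n} → Graph n → Permutation′ n → Set
IsAutomorphism Γ g = ∀ i j → Adj Γ i j ⇔ Adj Γ (g ⟨$⟩ʳ i) (g ⟨$⟩ʳ j)

VertexTransitive : ∀ {n} → (Permutation′ n → Set) → Set
VertexTransitive {n} G = ∀ (u v : Fin n) → ∃ λ g → G g × g ⟨$⟩ʳ u ≡ v

PreservesPartition : ∀ {n} (F : Rel (Fin n) 0ℓ) → Permutation′ n → Set
PreservesPartition F g = ∀ i j → F i j → F (g ⟨$⟩ʳ i) (g ⟨$⟩ʳ j)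

-- The group induced by G on Γ_C (g acts by κ i ↦ κ (g i)) is the dihedral
-- group of order 2m in its natural action on the m-cycle: under some
-- relabelling ψ of the cycles by Z_m, the induced permutations are exactly
-- the 2m maps x ↦ ±x + k.
InducedIsDihedral : ∀ {n m} (G : Permutation′ n → Set) (κ : Fin n → Fin m) → Set
InducedIsDihedral {n} {m} G κ = Σ (Permutation′ m) λ ψ →
  (∀ g → G g → ∃ λ ε → ∃ λ k → ∀ i →
      DihedralMap m ε k (toℕ (ψ ⟨$⟩ʳ κ i)) (toℕ (ψ ⟨$⟩ʳ κ (g ⟨$⟩ʳ i))))
  × (∀ ε k → ∃ λ g → G g × ∀ i →
      DihedralMap m ε k (toℕ (ψ ⟨$⟩ʳ κ i)) (toℕ (ψ ⟨$⟩ʳ κ (g ⟨$⟩ʳ i))))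

-- Number the cycles of the 2-factor by Z_m along the quotient cycle. An element g of G
-- permutes the cycles, and since it is an automorphism preserving the 2-factor it sends
-- consecutive cycles to consecutive cycles; being injective and m ≥ 3, the induced walk
-- x ↦ g x on Z_m never turns back, so it is x ↦ x + K or x ↦ K - x. Conversely, the 1-factor gives each
-- vertex a unique I-neighbour, so the element of G taking one end of an I-edge between
-- cycles 0 and 1 to one end of an I-edge between cycles 0 and m - 1 takes the other end
-- along too: it is the reflection x ↦ -x. Vertex-transitivity moves cycle 0 to cycle 1,
-- which together with that reflection yields the rotation x ↦ x + 1, and these two
-- generate all 2m dihedral maps.
module Submission where

open import Data.Bool using (Bool; true; false)
open import Data.Empty using (⊥-elim)
open import Data.Fin using (Fin; toℕ; fromℕ<)
open import Data.Fin.Permutation using (Permutation′; _⟨$⟩ʳ_; _⟨$⟩ˡ_; inverseˡ; inverseʳ)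
open import Data.Fin.Properties using (toℕ-injective; toℕ-fromℕ<; toℕ<n)
open import Data.List using (List; []; _∷_; length)
open import Data.List.Membership.Propositional using (_∈_)
open import Data.List.Membership.Propositional.Properties using (∈-filter⁺; ∈-allFin)
open import Data.List.Relation.Unary.Any using (here)
open import Data.Nat using (ℕ; zero; suc; _+_; _*_; _∸_; _≤_; _<_; s≤s; NonZero)
open import Data.Nat.DivMod
  using (_%_; _/_; m≡m%n+[m/n]*n; [m+kn]%n≡m%n; %-distribˡ-+; m%n%n≡m%n; m%n<n; m<n⇒m%n≡m)
open import Data.Nat.Properties
  using (+-comm; +-assoc; +-identityʳ; +-cancelʳ-≡; *-distribʳ-+; ≤-total; m+[n∸m]≡n;
         +-commutativeSemigroup)
open import Data.Product using (∃; ∃₂; _×_; _,_; proj₁; proj₂)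
open import Data.Sum as Sum using (_⊎_; inj₁; inj₂)
open import Function using (_∘_)
open import Function.Bundles using (Equivalence; _⇔_; mk⇔)
open import Level using (0ℓ)
open import Relation.Binary using (Rel; Decidable; Setoid; IsEquivalence)
open import Relation.Binary.Construct.Closure.ReflexiveTransitive using (gmap; return)
open import Relation.Binary.PropositionalEquality as ≡ using (_≡_; refl; cong; cong₂; subst₂)
import Relation.Binary.Reasoning.Setoid as SetoidReasoning
open import Relation.Nullary using (¬_)
open import Algebra.Properties.CommutativeSemigroup +-commutativeSemigroup using (xy∙z≈xz∙y)

open import Defs

module Congruence (m : ℕ) .{{_ : NonZero m}} where

  infix 4 _≈_
  record _≈_ (a b : ℕ) : Set where
    constructor mod≡
    field mod-≡ : a % m ≡ b % m

  ≈-isEquivalence : IsEquivalence _≈_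
  ≈-isEquivalence = record
    { refl  = mod≡ refl
    ; sym   = λ (mod≡ e) → mod≡ (≡.sym e)
    ; trans = λ (mod≡ e) (mod≡ e′) → mod≡ (≡.trans e e′)
    }

  ≈-setoid : Setoid 0ℓ 0ℓ
  ≈-setoid = record { isEquivalence = ≈-isEquivalence }

  open IsEquivalence ≈-isEquivalence public
    using () renaming (refl to ≈-refl; sym to ≈-sym; trans to ≈-trans)

  ≡⇒≈ : ∀ {a b} → a ≡ b → a ≈ b
  ≡⇒≈ e = mod≡ (cong (_% m) e)

  %-≈ : ∀ a → a % m ≈ a
  %-≈ a = mod≡ (m%n%n≡m%n a m)

  ≈⇒≡ : ∀ {a b} → a < m → b < m → a ≈ b → a ≡ b
  ≈⇒≡ a<m b<m (mod≡ e) = ≡.trans (≡.sym (m<n⇒m%n≡m a<m)) (≡.trans e (m<n⇒m%n≡m b<m))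

  +-cong : ∀ {a b c d} → a ≈ b → c ≈ d → a + c ≈ b + d
  +-cong {a} {b} {c} {d} (mod≡ e) (mod≡ e′) = mod≡ (begin
    (a + c) % m          ≡⟨ %-distribˡ-+ a c m ⟩
    (a % m + c % m) % m  ≡⟨ cong₂ (λ u v → (u + v) % m) e e′ ⟩
    (b % m + d % m) % m  ≡⟨ %-distribˡ-+ b d m ⟨
    (b + d) % m          ∎)
    where open ≡.≡-Reasoning

  +-congˡ : ∀ a {c d} → c ≈ d → a + c ≈ a + d
  +-congˡ a = +-cong (≈-refl {a})

  +-congʳ : ∀ {a b} c → a ≈ b → a + c ≈ b + c
  +-congʳ c e = +-cong e (≈-refl {c})

  CongMod⇒≈ : ∀ {a b} → CongMod m a b → a ≈ b
  CongMod⇒≈ {a} (q , inj₁ e) = mod≡ (≡.trans (≡.sym ([m+kn]%n≡m%n a q m)) (cong (_% m) e))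
  CongMod⇒≈ {_} {b} (q , inj₂ e) = mod≡ (≡.trans (≡.sym (cong (_% m) e)) ([m+kn]%n≡m%n b q m))

  m≈0 : m ≈ 0
  m≈0 = CongMod⇒≈ (1 , inj₂ (+-identityʳ m))

  private
    lift-quotient : ∀ {a b} → a % m ≡ b % m → a / m ≤ b / m → a + (b / m ∸ a / m) * m ≡ b
    lift-quotient {a} {b} e a/m≤b/m = begin
      a + (b / m ∸ a / m) * m                   ≡⟨ cong (_+ (b / m ∸ a / m) * m) (m≡m%n+[m/n]*n a m) ⟩
      a % m + a / m * m + (b / m ∸ a / m) * m   ≡⟨ +-assoc (a % m) _ _ ⟩
      a % m + (a / m * m + (b / m ∸ a / m) * m) ≡⟨ cong (a % m +_) (*-distribʳ-+ m (a / m) _) ⟨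
      a % m + (a / m + (b / m ∸ a / m)) * m     ≡⟨ cong₂ (λ u v → u + v * m) e (m+[n∸m]≡n a/m≤b/m) ⟩
      b % m + b / m * m                         ≡⟨ m≡m%n+[m/n]*n b m ⟨
      b                                         ∎
      where open ≡.≡-Reasoning

  ≈⇒CongMod : ∀ {a b} → a ≈ b → CongMod m a b
  ≈⇒CongMod {a} {b} (mod≡ e) with ≤-total (a / m) (b / m)
  ... | inj₁ a/m≤b/m = b / m ∸ a / m , inj₁ (lift-quotient e a/m≤b/m)
  ... | inj₂ b/m≤a/m = a / m ∸ b / m , inj₂ (lift-quotient (≡.sym e) b/m≤a/m)

  +-cancelʳ : ∀ {a b} c → a + c ≈ b + c → a ≈ b
  +-cancelʳ {a} {b} c e with ≈⇒CongMod e
  ... | q , inj₁ e′ = CongMod⇒≈ (q , inj₁ (+-cancelʳ-≡ c _ _ (≡.trans (xy∙z≈xz∙y a (q * m) c) e′)))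
  ... | q , inj₂ e′ = CongMod⇒≈ (q , inj₂ (+-cancelʳ-≡ c _ _ (≡.trans (xy∙z≈xz∙y b (q * m) c) e′)))

  Consecutive : ℕ → ℕ → Set
  Consecutive a b = a ≈ b + 1 ⊎ b ≈ a + 1

  Consecutive-resp-≈ : ∀ {a a′ b b′} → a ≈ a′ → b ≈ b′ → Consecutive a b → Consecutive a′ b′
  Consecutive-resp-≈ a≈a′ b≈b′ = Sum.map (λ e → ≈-trans (≈-sym a≈a′) (≈-trans e (+-congʳ 1 b≈b′)))
                                         (λ e → ≈-trans (≈-sym b≈b′) (≈-trans e (+-congʳ 1 a≈a′)))

  walk-rotation-or-reflection : (f : ℕ → ℕ) →
    (∀ x → Consecutive (f x) (f (suc x))) → (∀ x → ¬ f (2 + x) ≈ f x) →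
    (∀ x → f x ≈ x + f 0) ⊎ (∀ x → f x + x ≈ f 0)
  walk-rotation-or-reflection f step no-backtrack with step 0
  ... | inj₂ up   = inj₁ (rotation (forward up))
    where
    forward : f 1 ≈ f 0 + 1 → ∀ x → f (suc x) ≈ f x + 1
    forward up zero = up
    forward up (suc x) with step (suc x)
    ... | inj₂ up′   = up′
    ... | inj₁ down′ = ⊥-elim (no-backtrack x (+-cancelʳ 1 (≈-trans (≈-sym down′) (forward up x))))

    rotation : (∀ x → f (suc x) ≈ f x + 1) → ∀ x → f x ≈ x + f 0
    rotation up zero    = ≈-refl
    rotation up (suc x) = begin
      f (suc x)    ≈⟨ up x ⟩
      f x + 1      ≈⟨ +-congʳ 1 (rotation up x) ⟩
      x + f 0 + 1  ≡⟨ +-comm (x + f 0) 1 ⟩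
      suc x + f 0  ∎
      where open SetoidReasoning ≈-setoid
  ... | inj₁ down = inj₂ (reflection (backward down))
    where
    backward : f 0 ≈ f 1 + 1 → ∀ x → f x ≈ f (suc x) + 1
    backward down zero = down
    backward down (suc x) with step (suc x)
    ... | inj₁ down′ = down′
    ... | inj₂ up′   = ⊥-elim (no-backtrack x (≈-trans up′ (≈-sym (backward down x))))

    reflection : (∀ x → f x ≈ f (suc x) + 1) → ∀ x → f x + x ≈ f 0
    reflection down zero    = ≡⇒≈ (+-identityʳ (f 0))
    reflection down (suc x) = begin
      f (suc x) + suc x    ≡⟨ +-assoc (f (suc x)) 1 x ⟨
      f (suc x) + 1 + x    ≈⟨ +-congʳ x (down x) ⟨
      f x + x              ≈⟨ reflection down x ⟩
      f 0                  ∎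
      where open SetoidReasoning ≈-setoid

∈-length-1-unique : ∀ {A : Set} {xs : List A} {x y} → length xs ≡ 1 → x ∈ xs → y ∈ xs → x ≡ y
∈-length-1-unique {xs = _ ∷ []}    _  (here refl) (here refl) = refl
∈-length-1-unique {xs = _ ∷ _ ∷ _} () _           _

degree-1-functional : ∀ {n} {R : Rel (Fin n) 0ℓ} (R? : Decidable R) {i j j′} →
  degree R? i ≡ 1 → R i j → R i j′ → j ≡ j′
degree-1-functional R? {i} {j} {j′} deg Rij Rij′ =
  ∈-length-1-unique deg (∈-filter⁺ (R? i) (∈-allFin j) Rij) (∈-filter⁺ (R? i) (∈-allFin j′) Rij′)

preserved⇒reflected : ∀ {n} {G : Permutation′ n → Set} → IsSubgroup G →
  (R : Rel (Fin n) 0ℓ) → (∀ g → G g → PreservesPartition R g) →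
  ∀ g → G g → ∀ i j → R (g ⟨$⟩ʳ i) (g ⟨$⟩ʳ j) → R i j
preserved⇒reflected G-subgroup R preserves g g∈G i j with IsSubgroup.has-inv G-subgroup g g∈G
... | h , h∈G , h≗g⁻¹ = subst₂ R (cancel i) (cancel j) ∘ preserves h h∈G _ _
  where
  cancel : ∀ x → h ⟨$⟩ʳ (g ⟨$⟩ʳ x) ≡ x
  cancel x = ≡.trans (h≗g⁻¹ _) (inverseˡ g)

module InducedAction {n k} (Γ : Graph n) (F : Rel (Fin n) 0ℓ) (κ : Fin n → Fin (3 + k))
  (G : Permutation′ n → Set) (two-one-factor : TwoFactorOneFactor Γ F)
  (labelling : CycleLabelling F κ) (quotient-cycle : IsCycle (QAdj Γ κ))
  (G-subgroup : IsSubgroup G) (G-aut : ∀ g → G g → IsAutomorphism Γ g)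
  (G-transitive : VertexTransitive G) (G-preserves : ∀ g → G g → PreservesPartition F g)
  where

  m : ℕ
  m = 3 + k

  open Congruence m
  open TwoFactorOneFactor two-one-factor using (I?; I-1reg)
  open IsSubgroup G-subgroup using (has-id; has-mul)

  2≉0 : ¬ 2 ≈ 0
  2≉0 (mod≡ ())

  ψ : Permutation′ m
  ψ = proj₁ quotient-cycle

  cyclePos : Fin m → ℕ
  cyclePos a = toℕ (ψ ⟨$⟩ʳ a)

  cyclePos-injective : ∀ {a b} → cyclePos a ≡ cyclePos b → a ≡ b
  cyclePos-injective e =
    ≡.trans (≡.sym (inverseˡ ψ)) (≡.trans (cong (ψ ⟨$⟩ˡ_) (toℕ-injective e)) (inverseˡ ψ))

  cycleAt : ℕ → Fin m
  cycleAt x = ψ ⟨$⟩ˡ fromℕ< (m%n<n x m)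

  cyclePos-cycleAt : ∀ x → cyclePos (cycleAt x) ≈ x
  cyclePos-cycleAt x = ≈-trans (≡⇒≈ (≡.trans (cong toℕ (inverseʳ ψ)) (toℕ-fromℕ< _))) (%-≈ x)

  QAdj⇔Consecutive : ∀ a b → QAdj Γ κ a b ⇔ Consecutive (cyclePos a) (cyclePos b)
  QAdj⇔Consecutive a b = mk⇔ (Sum.map CongMod⇒≈ CongMod⇒≈ ∘ to)
                             (from ∘ Sum.map ≈⇒CongMod ≈⇒CongMod)
    where open Equivalence (proj₂ quotient-cycle a b)

  QAdj-cycleAt : ∀ {x y} → Consecutive x y → QAdj Γ κ (cycleAt x) (cycleAt y)
  QAdj-cycleAt xy = Equivalence.from (QAdj⇔Consecutive _ _)
    (Consecutive-resp-≈ (≈-sym (cyclePos-cycleAt _)) (≈-sym (cyclePos-cycleAt _)) xy)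

  position : Fin n → ℕ
  position i = cyclePos (κ i)

  position≈ : ∀ {i} x → κ i ≡ cycleAt x → position i ≈ x
  position≈ x e = ≈-trans (≡⇒≈ (cong cyclePos e)) (cyclePos-cycleAt x)

  cycleAt-position : ∀ i → cycleAt (position i) ≡ κ i
  cycleAt-position i = cyclePos-injective
    (≈⇒≡ (toℕ<n _) (toℕ<n _) (cyclePos-cycleAt (position i)))

  vertexAt : ℕ → Fin n
  vertexAt x = proj₁ (proj₁ labelling (cycleAt x))

  κ-vertexAt : ∀ x → κ (vertexAt x) ≡ cycleAt x
  κ-vertexAt x = proj₂ (proj₁ labelling (cycleAt x))

  SameCycle : Rel (Fin n) 0ℓ
  SameCycle i j = κ i ≡ κ j

  SameCycle-preserved : ∀ g → G g → PreservesPartition SameCycle g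
  SameCycle-preserved g g∈G i j =
    from (proj₂ labelling _ _) ∘ gmap (g ⟨$⟩ʳ_) (G-preserves g g∈G _ _) ∘ to (proj₂ labelling i j)
    where open Equivalence

  SameCycle-reflected : ∀ g → G g → ∀ i j → SameCycle (g ⟨$⟩ʳ i) (g ⟨$⟩ʳ j) → SameCycle i j
  SameCycle-reflected = preserved⇒reflected G-subgroup SameCycle SameCycle-preserved

  IEdge-preserved : ∀ g → G g → PreservesPartition (IEdge Γ F) g
  IEdge-preserved g g∈G i j (adj , ¬Fij) =
    Equivalence.to (G-aut g g∈G i j) adj ,
    ¬Fij ∘ preserved⇒reflected G-subgroup F G-preserves g g∈G i j

  QAdj⇒IEdge : ∀ {a b} → QAdj Γ κ a b → ∃₂ λ i j → κ i ≡ a × κ j ≡ b × IEdge Γ F i j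
  QAdj⇒IEdge (a≢b , i , j , κi , κj , adj) =
    i , j , κi , κj , adj ,
    λ Fij → a≢b (≡.trans (≡.sym κi) (≡.trans (Equivalence.from (proj₂ labelling i j) (return Fij)) κj))

  ActsAs : Bool → ℕ → Permutation′ n → Set
  ActsAs false K g = ∀ i → position (g ⟨$⟩ʳ i) ≈ position i + K
  ActsAs true  K g = ∀ i → position (g ⟨$⟩ʳ i) + position i ≈ K

  module Induced (g : Permutation′ n) (g∈G : G g) where

    induced : ℕ → ℕ
    induced x = position (g ⟨$⟩ʳ vertexAt x)

    position-g≡induced : ∀ {i} x → κ i ≡ cycleAt x → position (g ⟨$⟩ʳ i) ≡ induced x
    position-g≡induced x e =
      cong cyclePos (SameCycle-preserved g g∈G _ _ (≡.trans e (≡.sym (κ-vertexAt x))))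

    position-g≡induced-position : ∀ i → position (g ⟨$⟩ʳ i) ≡ induced (position i)
    position-g≡induced-position i = position-g≡induced (position i) (≡.sym (cycleAt-position i))

    induced-injective : ∀ {x y} → induced x ≈ induced y → x ≈ y
    induced-injective {x} {y} e = begin
      x                       ≈⟨ position≈ x (κ-vertexAt x) ⟨
      position (vertexAt x)   ≡⟨ cong cyclePos (SameCycle-reflected g g∈G _ _ κgx≡κgy) ⟩
      position (vertexAt y)   ≈⟨ position≈ y (κ-vertexAt y) ⟩
      y                       ∎
      where
      open SetoidReasoning ≈-setoid
      κgx≡κgy : κ (g ⟨$⟩ʳ vertexAt x) ≡ κ (g ⟨$⟩ʳ vertexAt y)
      κgx≡κgy = cyclePos-injective (≈⇒≡ (toℕ<n _) (toℕ<n _) e)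

    induced-consecutive : ∀ x → Consecutive (induced x) (induced (suc x))
    induced-consecutive x with QAdj-cycleAt {x} {suc x} (inj₂ (≡⇒≈ (+-comm 1 x)))
    ... | a≢b , i , j , κi , κj , adj =
      subst₂ Consecutive (position-g≡induced x κi) (position-g≡induced (suc x) κj)
        (Equivalence.to (QAdj⇔Consecutive _ _)
          (κgi≢κgj , _ , _ , refl , refl , Equivalence.to (G-aut g g∈G i j) adj))
      where
      κgi≢κgj : ¬ κ (g ⟨$⟩ʳ i) ≡ κ (g ⟨$⟩ʳ j)
      κgi≢κgj e = a≢b (≡.trans (≡.sym κi) (≡.trans (SameCycle-reflected g g∈G i j e) κj))

    induced-no-backtrack : ∀ x → ¬ induced (2 + x) ≈ induced x
    induced-no-backtrack x = 2≉0 ∘ +-cancelʳ x ∘ induced-injective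

    acts-dihedrally : ∃₂ λ ε K → ActsAs ε K g
    acts-dihedrally with walk-rotation-or-reflection induced induced-consecutive induced-no-backtrack
    ... | inj₁ rotation   = false , induced 0 , λ i →
      ≈-trans (≡⇒≈ (position-g≡induced-position i)) (rotation (position i))
    ... | inj₂ reflection = true , induced 0 , λ i →
      ≈-trans (≡⇒≈ (cong (_+ position i) (position-g≡induced-position i))) (reflection (position i))

  open Induced using (acts-dihedrally)

  Realised : Bool → ℕ → Set
  Realised ε K = ∃ λ g → G g × ActsAs ε K g

  Realised-resp-≈ : ∀ ε {K K′} → K ≈ K′ → Realised ε K → Realised ε K′
  Realised-resp-≈ false K≈K′ (g , g∈G , act) =
    g , g∈G , λ i → ≈-trans (act i) (+-congˡ (position i) K≈K′)
  Realised-resp-≈ true  K≈K′ (g , g∈G , act) = g , g∈G , λ i → ≈-trans (act i) K≈K′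

  identity-realised : Realised false 0
  identity-realised with has-id
  ... | e , e∈G , e-id =
    e , e∈G , λ i → ≡⇒≈ (≡.trans (cong position (e-id i)) (≡.sym (+-identityʳ _)))

  rotation-∘-rotation : ∀ {a b} → Realised false a → Realised false b → Realised false (b + a)
  rotation-∘-rotation {a} {b} (g , g∈G , g-act) (h , h∈G , h-act) with has-mul g h g∈G h∈G
  ... | c , c∈G , c≗gh = c , c∈G , λ i → begin
    position (c ⟨$⟩ʳ i)               ≡⟨ cong position (c≗gh i) ⟩
    position (g ⟨$⟩ʳ (h ⟨$⟩ʳ i))      ≈⟨ g-act (h ⟨$⟩ʳ i) ⟩
    position (h ⟨$⟩ʳ i) + a           ≈⟨ +-congʳ a (h-act i) ⟩
    position i + b + a                ≡⟨ +-assoc (position i) b a ⟩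
    position i + (b + a)              ∎
    where open SetoidReasoning ≈-setoid

  rotation-∘-reflection : ∀ {a b} → Realised false a → Realised true b → Realised true (b + a)
  rotation-∘-reflection {a} {b} (g , g∈G , g-act) (h , h∈G , h-act) with has-mul g h g∈G h∈G
  ... | c , c∈G , c≗gh = c , c∈G , λ i → begin
    position (c ⟨$⟩ʳ i) + position i             ≡⟨ cong (λ v → position v + position i) (c≗gh i) ⟩
    position (g ⟨$⟩ʳ (h ⟨$⟩ʳ i)) + position i    ≈⟨ +-congʳ (position i) (g-act (h ⟨$⟩ʳ i)) ⟩
    position (h ⟨$⟩ʳ i) + a + position i         ≡⟨ xy∙z≈xz∙y (position (h ⟨$⟩ʳ i)) a (position i) ⟩
    position (h ⟨$⟩ʳ i) + position i + a         ≈⟨ +-congʳ a (h-act i) ⟩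
    b + a                                        ∎
    where open SetoidReasoning ≈-setoid

  reflection-∘-reflection₀ : ∀ {a} → Realised true a → Realised true 0 → Realised false a
  reflection-∘-reflection₀ {a} (g , g∈G , g-act) (h , h∈G , h-act) with has-mul g h g∈G h∈G
  ... | c , c∈G , c≗gh = c , c∈G , λ i →
    let p-i   = position i
        p-hi  = position (h ⟨$⟩ʳ i)
        p-ghi = position (g ⟨$⟩ʳ (h ⟨$⟩ʳ i))
    in begin
    position (c ⟨$⟩ʳ i)   ≡⟨ cong position (c≗gh i) ⟩
    p-ghi                 ≡⟨ +-identityʳ p-ghi ⟨
    p-ghi + 0             ≈⟨ +-congˡ p-ghi (h-act i) ⟨
    p-ghi + (p-hi + p-i)  ≡⟨ +-assoc p-ghi p-hi p-i ⟨
    p-ghi + p-hi + p-i    ≈⟨ +-congʳ p-i (g-act (h ⟨$⟩ʳ i)) ⟩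
    a + p-i               ≡⟨ +-comm a p-i ⟩
    p-i + a               ∎
    where open SetoidReasoning ≈-setoid

  -- Choose I-edges ij from cycle 0 to cycle 1 and i′j′ from cycle 0 to cycle m-1, and g ∈ G
  -- with g i = i′. As I is a 1-factor, g j = j′, so g fixes cycle 0 and sends cycle 1 to
  -- cycle m-1: it cannot be a rotation.
  reflection₀ : Realised true 0
  reflection₀
    with QAdj⇒IEdge (QAdj-cycleAt {0} {1} (inj₂ ≈-refl))
       | QAdj⇒IEdge (QAdj-cycleAt {0} {2 + k} (inj₁ (≈-sym (≈-trans (≡⇒≈ (+-comm (2 + k) 1)) m≈0))))
  ... | i , j , κi , κj , ij | i′ , j′ , κi′ , κj′ , i′j′ with G-transitive i i′
  ... | g , g∈G , gi≡i′ with acts-dihedrally g g∈G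
  ... | true , K , reflects = Realised-resp-≈ true K≈0 (g , g∈G , reflects)
    where
    open SetoidReasoning ≈-setoid
    K≈0 : K ≈ 0
    K≈0 = begin
      K                                  ≈⟨ reflects i ⟨
      position (g ⟨$⟩ʳ i) + position i   ≡⟨ cong (λ v → position v + position i) gi≡i′ ⟩
      position i′ + position i           ≈⟨ +-cong (position≈ 0 κi′) (position≈ 0 κi) ⟩
      0                                  ∎
  ... | false , K , rotates = ⊥-elim (2≉0 (begin
      2                        ≈⟨ +-congʳ 1 m-1≈1 ⟨
      2 + k + 1                ≡⟨ +-comm (2 + k) 1 ⟩
      m                        ≈⟨ m≈0 ⟩
      0                        ∎))
    where
    open SetoidReasoning ≈-setoid
    gj≡j′ : g ⟨$⟩ʳ j ≡ j′
    gj≡j′ = degree-1-functional I? (I-1reg i′)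
      (≡.subst (λ v → IEdge Γ F v (g ⟨$⟩ʳ j)) gi≡i′ (IEdge-preserved g g∈G i j ij)) i′j′
    K≈0 : K ≈ 0
    K≈0 = begin
      K                          ≈⟨ +-congʳ K (position≈ 0 κi) ⟨
      position i + K             ≈⟨ rotates i ⟨
      position (g ⟨$⟩ʳ i)        ≡⟨ cong position gi≡i′ ⟩
      position i′                ≈⟨ position≈ 0 κi′ ⟩
      0                          ∎
    m-1≈1 : 2 + k ≈ 1
    m-1≈1 = begin
      2 + k                      ≈⟨ position≈ (2 + k) κj′ ⟨
      position j′                ≡⟨ cong position gj≡j′ ⟨
      position (g ⟨$⟩ʳ j)        ≈⟨ rotates j ⟩
      position j + K             ≈⟨ +-cong (position≈ 1 κj) K≈0 ⟩
      1                          ∎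

  -- An element of G carrying cycle 0 to cycle 1 is either the rotation by 1 or, composed
  -- with reflection₀, yields it.
  rotation₁ : Realised false 1
  rotation₁ with G-transitive (vertexAt 0) (vertexAt 1)
  ... | t , t∈G , t0≡1 with acts-dihedrally t t∈G
  ... | false , K , rotates = Realised-resp-≈ false K≈1 (t , t∈G , rotates)
    where
    open SetoidReasoning ≈-setoid
    K≈1 : K ≈ 1
    K≈1 = begin
      K                                 ≈⟨ +-congʳ K (position≈ 0 (κ-vertexAt 0)) ⟨
      position (vertexAt 0) + K         ≈⟨ rotates (vertexAt 0) ⟨
      position (t ⟨$⟩ʳ vertexAt 0)      ≡⟨ cong position t0≡1 ⟩
      position (vertexAt 1)             ≈⟨ position≈ 1 (κ-vertexAt 1) ⟩
      1                                 ∎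
  ... | true , K , reflects =
    Realised-resp-≈ false K≈1 (reflection-∘-reflection₀ (t , t∈G , reflects) reflection₀)
    where
    open SetoidReasoning ≈-setoid
    K≈1 : K ≈ 1
    K≈1 = begin
      K                                   ≈⟨ reflects v₀ ⟨
      position (t ⟨$⟩ʳ v₀) + position v₀  ≡⟨ cong (λ v → position v + position v₀) t0≡1 ⟩
      position v₁ + position v₀           ≈⟨ +-cong (position≈ 1 (κ-vertexAt 1)) (position≈ 0 (κ-vertexAt 0)) ⟩
      1                                   ∎
      where
      v₀ v₁ : Fin n
      v₀ = vertexAt 0
      v₁ = vertexAt 1

  rotation : ∀ K → Realised false K
  rotation zero    = identity-realised
  rotation (suc K) =
    Realised-resp-≈ false (≡⇒≈ (+-comm K 1)) (rotation-∘-rotation rotation₁ (rotation K))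

  realised : ∀ ε K → Realised ε K
  realised false = rotation
  realised true  = λ K → rotation-∘-reflection (rotation K) reflection₀

  ActsAs⇒DihedralMap : ∀ ε {K} g → ActsAs ε K g →
    ∀ i → DihedralMap m ε K (position i) (position (g ⟨$⟩ʳ i))
  ActsAs⇒DihedralMap false _ act = ≈⇒CongMod ∘ act
  ActsAs⇒DihedralMap true  _ act = ≈⇒CongMod ∘ act

  induced-dihedral : InducedIsDihedral G κ
  induced-dihedral = ψ , dihedral-of-element , element-of-dihedral
    where
    dihedral-of-element : ∀ g → G g →
      ∃₂ λ ε K → ∀ i → DihedralMap m ε K (position i) (position (g ⟨$⟩ʳ i))
    dihedral-of-element g g∈G with acts-dihedrally g g∈G
    ... | ε , K , act = ε , K , ActsAs⇒DihedralMap ε g act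
    element-of-dihedral : ∀ ε K →
      ∃ λ g → G g × ∀ i → DihedralMap m ε K (position i) (position (g ⟨$⟩ʳ i))
    element-of-dihedral ε K with realised ε K
    ... | g , g∈G , act = g , g∈G , ActsAs⇒DihedralMap ε g act

proposition3p1 : ∀ {n m : ℕ} (Γ : Graph n) (F : Rel (Fin n) 0ℓ) (κ : Fin n → Fin m)
    (G : Permutation′ n → Set) →
    Connected Γ → Cubic Γ → TwoFactorOneFactor Γ F →
    CycleLabelling F κ → 3 ≤ m → IsCycle (QAdj Γ κ) →
    IsSubgroup G → (∀ g → G g → IsAutomorphism Γ g) →
    VertexTransitive G → (∀ g → G g → PreservesPartition F g) →
    InducedIsDihedral G κ
proposition3p1 Γ F κ G _ _ two-one-factor labelling (s≤s (s≤s (s≤s _))) =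
  InducedAction.induced-dihedral Γ F κ G two-one-factor labelling
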